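{- Let $(S,+)$ be a countable commutative semigroup such that for every $d\in\mathbb{N}$ the set $dS=\{dx:x\in S\}$ is piecewise syndetic in $S$. Let $M\subseteq S\times S$ be piecewise syndetic in $S\times S$. Then for any $d\in\mathbb{N}$, the set \[ \{(s,dt):(s,t)\in M\} \] is piecewise syndetic in $S\times S$.
   Context: $\mathbb{N}=\{1,2,3,\ldots\}$. For $n\in\mathbb{N}$ and $t\in S$, $nt$ denotes $t+t+\cdots+t$ ($n$ summands). $S\times S$ carries the coordinatewise operation. For a commutative semigroup $(T,+)$, $x\in T$ and $A\subseteq T$, write $-x+A=\{y\in T: x+y\in A\}$. A set $A\subseteq T$ is thick if for every finite $H\subseteq T$ there is $x\in T$ with $H+x\subseteq A$. A set $A\subseteq T$ is piecewise syndetic if there is a finite set $F\subseteq T$ such that $\bigcup_{x\in F}(-x+A)$ is thick. (The paper calls semigroups satisfying the hypothesis on $dS$ "of class $\mathscr{A}$".) -}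

module Defs where

open import Level using (Level; _⊔_; suc)
open import Data.Nat using (ℕ; zero; NonZero)
import Data.Nat as ℕ
open import Data.Product using (Σ; ∃; ∃-syntax; _×_; _,_)
open import Data.List using (List)
open import Data.List.Membership.Propositional using (_∈_)
open import Data.List.Relation.Unary.Any using (Any)
open import Function.Definitions using (Injective)
open import Relation.Binary.PropositionalEquality using (_≡_)

record CommSemigroup : Set₁ where
  field
    Carrier : Set
    _+_     : Carrier → Carrier → Carrier
    assoc   : ∀ x y z → (x + y) + z ≡ x + (y + z)
    comm    : ∀ x y → x + y ≡ y + x

Countable : Set → Set
Countable A = Σ (A → ℕ) λ f → Injective _≡_ _≡_ f

Subset : Set → Set₁
Subset A = A → Set

module _ (T : CommSemigroup) where
  open CommSemigroup T

  -- n t = t + t + ... + t (n summands), for n ≥ 1; 0·t := t is a junk value never used.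
  _·_ : ℕ → Carrier → Carrier
  zero · t = t
  ℕ.suc zero · t = t
  ℕ.suc (ℕ.suc n) · t = (ℕ.suc n · t) + t

  -_+_ : Carrier → Subset Carrier → Subset Carrier
  (- x + A) y = A (x + y)

  Thick : Subset Carrier → Set
  Thick A = (H : List Carrier) → ∃[ x ] (∀ {h} → h ∈ H → A (h + x))

  PiecewiseSyndetic : Subset Carrier → Set
  PiecewiseSyndetic A =
    ∃[ F ] Thick (λ y → Any (λ x → (- x + A) y) F)

  multiples : ℕ → Subset Carrier
  multiples d y = ∃[ x ] (y ≡ d · x)

_×ₛ_ : CommSemigroup → CommSemigroup → CommSemigroup
S ×ₛ T = record
  { Carrier = S.Carrier × T.Carrier
  ; _+_ = λ { (a , b) (c , e) → (a S.+ c) , (b T.+ e) }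
  ; assoc = λ { (a , b) (c , e) (f , g) → cong₂ _,_ (S.assoc a c f) (T.assoc b e g) }
  ; comm = λ { (a , b) (c , e) → cong₂ _,_ (S.comm a c) (T.comm b e) }
  }
  where
    module S = CommSemigroup S
    module T = CommSemigroup T
    open import Relation.Binary.PropositionalEquality using (cong₂)

-- If the translates
-- -(a, b) + M (for (a, b) ∈ F) cover a thick set and the translates -g + dS (for g ∈ G) do
-- too, then the translates by (a, d b + g) cover a thick set for the image of M: given a
-- finite H, first shift the second coordinates of H by z into ⋃ (-g + dS), writing
-- g + h₂ + z = d y, then shift the finite set of pairs (h₁, y) by (u, v) into ⋃ (-(a, b) + M);
-- the shift (u, z + d v) then moves every h into the right translate, because
-- (d b + g) + (h₂ + z + d v) = d (b + y + v).
module Submission where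

open import Defs
open import Level using (0ℓ)
open import Algebra.Bundles using (CommutativeSemigroup)
import Algebra.Properties.CommutativeSemigroup as CommutativeSemigroupProperties
open import Data.Nat using (ℕ; zero; suc; NonZero)
open import Data.Product using (∃-syntax; _×_; _,_; proj₁; proj₂)
open import Data.List using (List; cartesianProductWith)
open import Data.List.Relation.Unary.Any using (Any)
open import Data.List.Relation.Unary.Any.Properties using (mapWith∈⁺)
open import Data.List.Membership.Propositional using (_∈_; mapWith∈; find; lose)
open import Data.List.Membership.Propositional.Properties using (∈-cartesianProductWith⁺)
open import Relation.Binary.PropositionalEquality
  using (_≡_; refl; sym; cong; cong₂; isEquivalence; module ≡-Reasoning)

toCommutativeSemigroup : CommSemigroup → CommutativeSemigroup 0ℓ 0ℓ
toCommutativeSemigroup S = record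
  { _≈_ = _≡_
  ; _∙_ = _+_
  ; isCommutativeSemigroup = record
    { isSemigroup = record
      { isMagma = record { isEquivalence = isEquivalence ; ∙-cong = cong₂ _+_ }
      ; assoc = assoc
      }
    ; comm = comm
    }
  }
  where open CommSemigroup S

module _ (T : CommSemigroup) where
  open CommSemigroup T

  thick-mapWith∈ : ∀ {A : Subset Carrier} {X : Set} → Thick T A →
                   (H : List X) (f : ∀ {h} → h ∈ H → Carrier) →
                   ∃[ x ] (∀ {h} (h∈H : h ∈ H) → A (f h∈H + x))
  thick-mapWith∈ thick H f with thick (mapWith∈ H f)
  ... | x , inA = x , λ h∈H → inA (mapWith∈⁺ f (_ , h∈H , refl))

module _ (S : CommSemigroup) where
  open CommSemigroup S
  open CommutativeSemigroupProperties (toCommutativeSemigroup S) using (interchange)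

  infixr 25 _·ₛ_
  _·ₛ_ : ℕ → Carrier → Carrier
  _·ₛ_ = _·_ S

  -- Also for d = 0, where the junk value 0 · t = t is the identity.
  ·-distrib-+ : ∀ d p q → d ·ₛ (p + q) ≡ d ·ₛ p + d ·ₛ q
  ·-distrib-+ zero          p q = refl
  ·-distrib-+ (suc zero)    p q = refl
  ·-distrib-+ (suc (suc n)) p q = begin
    (suc n ·ₛ (p + q)) + (p + q)            ≡⟨ cong (_+ (p + q)) (·-distrib-+ (suc n) p q) ⟩
    (suc n ·ₛ p + suc n ·ₛ q) + (p + q)     ≡⟨ interchange _ _ p q ⟩
    (suc n ·ₛ p + p) + (suc n ·ₛ q + q)     ∎
    where open ≡-Reasoning

  translate-multiple : ∀ d {g h z y} → g + (h + z) ≡ d ·ₛ y →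
                       ∀ b v → (d ·ₛ b + g) + (h + (z + d ·ₛ v)) ≡ d ·ₛ (b + (y + v))
  translate-multiple d {g} {h} {z} {y} g+h+z≡dy b v = begin
    (d ·ₛ b + g) + (h + (z + d ·ₛ v))     ≡⟨ assoc (d ·ₛ b) g _ ⟩
    d ·ₛ b + (g + (h + (z + d ·ₛ v)))     ≡⟨ cong (λ w → d ·ₛ b + (g + w)) (sym (assoc h z _)) ⟩
    d ·ₛ b + (g + ((h + z) + d ·ₛ v))     ≡⟨ cong (d ·ₛ b +_) (sym (assoc g _ _)) ⟩
    d ·ₛ b + ((g + (h + z)) + d ·ₛ v)     ≡⟨ cong (λ w → d ·ₛ b + (w + d ·ₛ v)) g+h+z≡dy ⟩
    d ·ₛ b + (d ·ₛ y + d ·ₛ v)            ≡⟨ cong (d ·ₛ b +_) (sym (·-distrib-+ d y v)) ⟩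
    d ·ₛ b + d ·ₛ (y + v)                 ≡⟨ sym (·-distrib-+ d b (y + v)) ⟩
    d ·ₛ (b + (y + v))                    ∎
    where open ≡-Reasoning

  scaleSecond : ℕ → Subset (Carrier × Carrier) → Subset (Carrier × Carrier)
  scaleSecond d M p = ∃[ s ] ∃[ t ] (M (s , t) × (p ≡ (s , d ·ₛ t)))

  scaleSecond-piecewiseSyndetic : ∀ d {M} → PiecewiseSyndetic S (multiples S d) →
                                  PiecewiseSyndetic (S ×ₛ S) M →
                                  PiecewiseSyndetic (S ×ₛ S) (scaleSecond d M)
  scaleSecond-piecewiseSyndetic d {M} (G , thickG) (F , thickF) = F′ , thickF′
    where
      shift : Carrier × Carrier → Carrier → Carrier × Carrier
      shift (a , b) g = a , d ·ₛ b + g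

      F′ : List (Carrier × Carrier)
      F′ = cartesianProductWith shift F G

      thickF′ : Thick (S ×ₛ S) (λ p → Any (λ x → (- S ×ₛ S + x) (scaleSecond d M) p) F′)
      thickF′ H = (u , z + d ·ₛ v) , translated
        where
          open CommSemigroup (S ×ₛ S) using () renaming (_+_ to _⊕_)

          G-covers : Subset Carrier
          G-covers y = Any (λ g → (- S + g) (multiples S d) y) G

          F-covers : Subset (Carrier × Carrier)
          F-covers p = Any (λ x → (- S ×ₛ S + x) M p) F

          z-spec : ∃[ z ] (∀ {h} → h ∈ H → G-covers (proj₂ h + z))
          z-spec = thick-mapWith∈ S {A = G-covers} thickG H (λ {h} _ → proj₂ h)

          z : Carrier
          z = proj₁ z-spec

          multipleAt : ∀ {h} → h ∈ H → ∃[ g ] (g ∈ G × ∃[ y ] (g + (proj₂ h + z) ≡ d ·ₛ y))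
          multipleAt h∈H = find (proj₂ z-spec h∈H)

          quotientAt : ∀ {h} → h ∈ H → Carrier
          quotientAt h∈H with multipleAt h∈H
          ... | _ , _ , y , _ = y

          pairAt : ∀ {h} → h ∈ H → Carrier × Carrier
          pairAt {h₁ , _} h∈H = h₁ , quotientAt h∈H

          uv-spec : ∃[ uv ] (∀ {h} (h∈H : h ∈ H) → F-covers (pairAt h∈H ⊕ uv))
          uv-spec = thick-mapWith∈ (S ×ₛ S) {A = F-covers} thickF H pairAt

          u v : Carrier
          u = proj₁ (proj₁ uv-spec)
          v = proj₂ (proj₁ uv-spec)

          translated : ∀ {h} → h ∈ H →
                       Any (λ x → (- S ×ₛ S + x) (scaleSecond d M) (h ⊕ (u , z + d ·ₛ v))) F′
          translated {h₁ , h₂} h∈H with multipleAt h∈H | find (proj₂ uv-spec h∈H)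
          ... | g , g∈G , y , g+h₂+z≡dy | (a , b) , ab∈F , inM =
            lose (∈-cartesianProductWith⁺ shift ab∈F g∈G)
                 (a + (h₁ + u) , b + (y + v) , inM , cong (_ ,_) (translate-multiple d g+h₂+z≡dy b v))

lemma8 : (S : CommSemigroup) → Countable (CommSemigroup.Carrier S) →
           ((d : ℕ) → NonZero d → PiecewiseSyndetic S (multiples S d)) →
           (M : Subset (CommSemigroup.Carrier S × CommSemigroup.Carrier S)) →
           PiecewiseSyndetic (S ×ₛ S) M →
           (d : ℕ) → NonZero d →
           PiecewiseSyndetic (S ×ₛ S)
             (λ p → ∃[ s ] ∃[ t ] (M (s , t) × (p ≡ (s , _·_ S d t))))
lemma8 S _ multiples-psd M M-psd d d≢0 =
  scaleSecond-piecewiseSyndetic S d (multiples-psd d d≢0) M-psd
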